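{- Let $p\geqslant 3$ be an odd prime and let $S\subseteq D_{2p}$ satisfy $1\notin S$, $S=S^{ -1}$ and $\langle S\rangle=D_{2p}$. Let $S_1=S\cap \langle\alpha\rangle$. If $|S_1|=0$, then the Cayley graph $Cay(D_{2p},S)$ has a Hamilton decomposition.
   Context: For $n\geqslant 2$, the dihedral group $D_{2n}$ is the group generated by two elements $\alpha,\beta$ subject to $\alpha^n=\beta^2=1$ and $\beta\alpha\beta=\alpha^{ -1}$. For a group $G$ and a subset $S\subseteq G$ with $1\notin S$, $S=S^{ -1}$ and $\langle S\rangle=G$, the Cayley graph $Cay(G,S)$ is the simple graph with vertex set $G$ in which $g,h\in G$ are adjacent iff $hg^{ -1}\in S$; it is regular of valency $|S|$. A regular graph of valency $2k$ has a Hamilton decomposition if its edge set can be partitioned into $k$ Hamilton cycles; a regular graph of valency $2k-1$ has a Hamilton decomposition if its edge set can be partitioned into $k-1$ Hamilton cycles and a perfect matching (here $k\geqslant 1$; in particular a connected $2$-regular graph, being a Hamilton cycle, has a Hamilton decomposition). -}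

module Defs where

open import Data.Nat using (ℕ; zero; suc; _+_; _*_; _∸_)
open import Data.Nat.DivMod using (_mod_)
open import Data.Fin using (Fin; toℕ)
open import Data.Bool using (Bool; true; false; _xor_; _≟_)
open import Data.Product using (Σ; ∃; _×_; _,_; proj₁; proj₂)
open import Data.Sum using (_⊎_)
open import Data.List using (List; filter; length)
open import Data.List.Membership.Propositional using (_∈_)
open import Relation.Nullary using (¬_)
open import Relation.Binary.PropositionalEquality using (_≡_)
open import Function.Definitions using (Injective)

-- Elements of the dihedral group D_{2n}: the pair (i , b) stands for α^i β^b
-- (i taken mod n, b = true meaning one factor β).
D : ℕ → Set
D n = Fin n × Bool

addF : ∀ {n} → Fin n → Fin n → Fin n
addF {zero} ()
addF {suc m} i j = (toℕ i + toℕ j) mod suc m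

negF : ∀ {n} → Fin n → Fin n
negF {zero} ()
negF {suc m} i = (suc m ∸ toℕ i) mod suc m

-- α^i β^a · α^j β^b = α^(i + (-1)^a j) β^(a xor b)   (using β α^j = α^(-j) β)
_·_ : ∀ {n} → D n → D n → D n
(i , false) · (j , b) = (addF i j , b)
(i , true)  · (j , b) = (addF i (negF j) , true xor b)

inv : ∀ {n} → D n → D n
inv (i , false) = (negF i , false)
inv (i , true)  = (i , true)

IsOne : ∀ {n} → D n → Set
IsOne (i , b) = (toℕ i ≡ 0) × (b ≡ false)

-- the subgroup generated by S (finite group, so products of elements of S suffice)
data Generated {n : ℕ} (S : List (D n)) : D n → Set where
  gen-one : ∀ {g} → IsOne g → Generated S g
  gen-mul : ∀ {s g} → s ∈ S → Generated S g → Generated S (s · g)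

S₁ : ∀ {n} → List (D n) → List (D n)
S₁ S = filter (λ s → proj₂ s ≟ false) S

Adj : ∀ {n} → List (D n) → D n → D n → Set
Adj S g h = (h · inv g) ∈ S

next : ∀ {N} → Fin N → Fin N
next {zero} ()
next {suc m} i = suc (toℕ i) mod suc m

record HamCycle (n : ℕ) (S : List (D n)) : Set where
  field
    cyc : Fin (2 * n) → D n
    inj : Injective _≡_ _≡_ cyc
    adj : ∀ i → Adj S (cyc i) (cyc (next i))
open HamCycle public

OnCycle : ∀ {n S} → HamCycle n S → D n → D n → Set
OnCycle C g h = ∃ λ i → ((cyc C i ≡ g) × (cyc C (next i) ≡ h))
                      ⊎ ((cyc C i ≡ h) × (cyc C (next i) ≡ g))

-- a perfect matching of Cay(D_{2n},S), as a fixed-point-free involution along edges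
record PerfectMatching (n : ℕ) (S : List (D n)) : Set where
  field
    mate    : D n → D n
    invol   : ∀ g → mate (mate g) ≡ g
    mateAdj : ∀ g → Adj S g (mate g)
open PerfectMatching public

InMatching : ∀ {n S} → PerfectMatching n S → D n → D n → Set
InMatching M g h = h ≡ mate M g

ExactlyOne : ∀ {k} → (Fin k → Set) → Set
ExactlyOne {k} P = ∃ λ i → P i × (∀ j → P j → j ≡ i)

-- Hamilton decomposition of Cay(D_{2n},S), a regular graph of valency |S|
-- (S is given as a duplicate-free list, so |S| = length S):
--  * |S| = 2k : edges partitioned into k Hamilton cycles;
--  * |S| = 2k-1 : edges partitioned into k-1 Hamilton cycles and a perfect matching.
HamDecomposition : (n : ℕ) → List (D n) → Set
HamDecomposition n S =
    (Σ ℕ λ k → (length S ≡ 2 * k) ×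
       (Σ (Fin k → HamCycle n S) λ cs →
          ∀ g h → Adj S g h → ExactlyOne (λ i → OnCycle (cs i) g h)))
  ⊎ (Σ ℕ λ k → (length S + 1 ≡ 2 * k) ×
       (Σ (Fin (k ∸ 1) → HamCycle n S) λ cs → Σ (PerfectMatching n S) λ M →
          ∀ g h → Adj S g h →
            (InMatching M g h × (∀ i → ¬ OnCycle (cs i) g h))
            ⊎ (¬ InMatching M g h × ExactlyOne (λ i → OnCycle (cs i) g h))))

-- Every element of S is a reflection α^c β, and the edges of Cay(D_2p, S) labelled by
-- α^c β form the perfect matching g ↦ α^c β · g.  Pair the reflections up.  For a pair
-- a ≠ b, applying the two matchings alternately to 1 visits α^(t d) and α^(a - t d) β with
-- d = b - a, t = 0, 1, ...; as p is prime and d ≠ 0 these are all 2p vertices, so the union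
-- of the two matchings is one Hamilton cycle.  Distinct pairs give edge-disjoint cycles, and
-- a leftover reflection, when |S| is odd, is the perfect matching.

module Submission where

open import Defs
open import Data.Bool using (Bool; true; false)
open import Data.Empty using (⊥-elim)
open import Data.Fin using (Fin; zero; suc; toℕ; fromℕ<)
open import Data.Fin.Patterns using (0F)
open import Data.Fin.Properties using (toℕ-injective; toℕ<n; toℕ-fromℕ<)
open import Data.List using (List; []; _∷_; length)
open import Data.List.Membership.Propositional using (_∈_; _∉_)
open import Data.List.Relation.Unary.All using (All; []; _∷_)
open import Data.List.Relation.Unary.All.Properties using (All¬⇒¬Any)
open import Data.List.Relation.Unary.AllPairs using (_∷_)
open import Data.List.Relation.Unary.Any using (here; there)
open import Data.List.Relation.Unary.Unique.Propositional using (Unique)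
open import Data.Nat using (ℕ; zero; suc; _+_; _*_; _∸_; _<_; _≤_; NonZero; ≢-nonZero)
open import Data.Nat.Coprimality using (prime⇒coprime; coprime-Bézout)
open import Data.Nat.DivMod
  using ( _%_; _mod_; %-distribˡ-+; %-distribˡ-*; m%n%n≡m%n; [m+n]%n≡m%n; [m+kn]%n≡m%n
        ; m<n⇒m%n≡m; n%n≡0; m*n%n≡0; m%n<n)
open import Data.Nat.GCD using (module Bézout)
open import Data.Nat.Primality using (Prime)
open import Data.Nat.Properties
  using ( +-comm; +-assoc; *-comm; *-assoc; *-identityʳ; *-suc; m∸n+n≡m; <⇒≤; ≤-refl; n≤1+n
        ; ≤-<-trans; *-cancelˡ-<; *-monoʳ-<; *-monoʳ-≤; m≤n⇒m<n∨m≡n)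
open import Data.Nat.Tactic.RingSolver using (solve-∀)
open import Data.Product using (∃; ∃₂; _×_; _,_; proj₁; proj₂; map₂)
open import Data.Sum using (_⊎_; inj₁; inj₂)
import Data.Sum as Sum
open import Function using (_∘_; id)
open import Relation.Binary.PropositionalEquality
open import Relation.Nullary using (¬_)

private variable n : ℕ

[m%d+n]%d≡[m+n]%d : ∀ m n d .{{_ : NonZero d}} → (m % d + n) % d ≡ (m + n) % d
[m%d+n]%d≡[m+n]%d m n d = begin
  (m % d + n) % d          ≡⟨ %-distribˡ-+ (m % d) n d ⟩
  (m % d % d + n % d) % d  ≡⟨ cong (λ x → (x + n % d) % d) (m%n%n≡m%n m d) ⟩
  (m % d + n % d) % d      ≡⟨ %-distribˡ-+ m n d ⟨
  (m + n) % d              ∎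
  where open ≡-Reasoning

[m+n%d]%d≡[m+n]%d : ∀ m n d .{{_ : NonZero d}} → (m + n % d) % d ≡ (m + n) % d
[m+n%d]%d≡[m+n]%d m n d = begin
  (m + n % d) % d ≡⟨ cong (_% d) (+-comm m (n % d)) ⟩
  (n % d + m) % d ≡⟨ [m%d+n]%d≡[m+n]%d n m d ⟩
  (n + m) % d     ≡⟨ cong (_% d) (+-comm n m) ⟩
  (m + n) % d     ∎
  where open ≡-Reasoning

[m%d*n]%d≡[m*n]%d : ∀ m n d .{{_ : NonZero d}} → (m % d * n) % d ≡ (m * n) % d
[m%d*n]%d≡[m*n]%d m n d = begin
  (m % d * n) % d            ≡⟨ %-distribˡ-* (m % d) n d ⟩
  (m % d % d * (n % d)) % d  ≡⟨ cong (λ x → (x * (n % d)) % d) (m%n%n≡m%n m d) ⟩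
  (m % d * (n % d)) % d      ≡⟨ %-distribˡ-* m n d ⟨
  (m * n) % d                ∎
  where open ≡-Reasoning

[m*n%d]%d≡[m*n]%d : ∀ m n d .{{_ : NonZero d}} → (m * (n % d)) % d ≡ (m * n) % d
[m*n%d]%d≡[m*n]%d m n d = begin
  (m * (n % d)) % d ≡⟨ cong (_% d) (*-comm m (n % d)) ⟩
  (n % d * m) % d   ≡⟨ [m%d*n]%d≡[m*n]%d n m d ⟩
  (n * m) % d       ≡⟨ cong (_% d) (*-comm n m) ⟩
  (m * n) % d       ∎
  where open ≡-Reasoning

*-inverse-cancel : ∀ {z x} d .{{_ : NonZero d}} → (z * x) % d ≡ 1 % d → ∀ t → (t * x * z) % d ≡ t % d
*-inverse-cancel {z} {x} d zx≡1 t = begin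
  (t * x * z) % d          ≡⟨ cong (_% d) (rearrange t x z) ⟩
  (t * (z * x)) % d        ≡⟨ [m*n%d]%d≡[m*n]%d t (z * x) d ⟨
  (t * ((z * x) % d)) % d  ≡⟨ cong (λ y → (t * y) % d) zx≡1 ⟩
  (t * (1 % d)) % d        ≡⟨ [m*n%d]%d≡[m*n]%d t 1 d ⟩
  (t * 1) % d              ≡⟨ cong (_% d) (*-identityʳ t) ⟩
  t % d                    ∎
  where
  open ≡-Reasoning
  rearrange : ∀ t x z → t * x * z ≡ t * (z * x)
  rearrange = solve-∀

*-inverse-mod : Prime (suc n) → ∀ x .{{_ : NonZero x}} → x < suc n →
                ∃ λ z → (z * x) % suc n ≡ 1 % suc n
*-inverse-mod {n} p-prime x x<p with coprime-Bézout (prime⇒coprime p-prime x<p)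
... | Bézout.-+ u y 1+up≡yx = y , trans (cong (_% suc n) (sym 1+up≡yx)) ([m+kn]%n≡m%n 1 u (suc n))
-- in this case y x ≡ -1 (mod p), so n y x ≡ -n ≡ 1
... | Bézout.+- u y 1+yx≡up = n * y , (begin
  (n * y * x) % suc n                ≡⟨ [m+n]%n≡m%n (n * y * x) (suc n) ⟨
  (n * y * x + suc n) % suc n        ≡⟨ cong (_% suc n) (begin
     n * y * x + suc n               ≡⟨ rearrange n y x ⟩
     1 + n * (1 + y * x)             ≡⟨ cong (λ m → 1 + n * m) 1+yx≡up ⟩
     1 + n * (u * suc n)             ≡⟨ cong (1 +_) (*-assoc n u (suc n)) ⟨
     1 + n * u * suc n               ∎) ⟩
  (1 + n * u * suc n) % suc n        ≡⟨ [m+kn]%n≡m%n 1 (n * u) (suc n) ⟩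
  1 % suc n                          ∎)
  where
  open ≡-Reasoning
  rearrange : ∀ n y x → n * y * x + suc n ≡ 1 + n * (1 + y * x)
  rearrange = solve-∀

infixl 6 _⊕_ _⊖_
infixl 7 _⊙_

_⊕_ : Fin (suc n) → Fin (suc n) → Fin (suc n)
_⊕_ = addF

_⊖_ : Fin (suc n) → Fin (suc n) → Fin (suc n)
i ⊖ j = i ⊕ negF j

_⊙_ : ℕ → Fin (suc n) → Fin (suc n)
_⊙_ {n} t d = (t * toℕ d) mod suc n

toℕ-mod : ∀ m → toℕ (m mod suc n) ≡ m % suc n
toℕ-mod m = toℕ-fromℕ< _

%≡%⇒mod≡mod : ∀ m m′ → m % suc n ≡ m′ % suc n → m mod suc n ≡ m′ mod suc n
%≡%⇒mod≡mod m m′ eq = toℕ-injective (trans (toℕ-mod m) (trans eq (sym (toℕ-mod m′))))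

⊕-comm : (i j : Fin (suc n)) → i ⊕ j ≡ j ⊕ i
⊕-comm i j = cong (_mod _) (+-comm (toℕ i) (toℕ j))

⊕-assoc : (i j k : Fin (suc n)) → (i ⊕ j) ⊕ k ≡ i ⊕ (j ⊕ k)
⊕-assoc {n} i j k = %≡%⇒mod≡mod (toℕ (i ⊕ j) + toℕ k) (toℕ i + toℕ (j ⊕ k)) (begin
  (toℕ (i ⊕ j) + toℕ k) % suc n                ≡⟨ cong (λ x → (x + toℕ k) % suc n) (toℕ-mod (toℕ i + toℕ j)) ⟩
  ((toℕ i + toℕ j) % suc n + toℕ k) % suc n    ≡⟨ [m%d+n]%d≡[m+n]%d (toℕ i + toℕ j) (toℕ k) (suc n) ⟩
  (toℕ i + toℕ j + toℕ k) % suc n              ≡⟨ cong (_% suc n) (+-assoc (toℕ i) (toℕ j) (toℕ k)) ⟩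
  (toℕ i + (toℕ j + toℕ k)) % suc n            ≡⟨ [m+n%d]%d≡[m+n]%d (toℕ i) (toℕ j + toℕ k) (suc n) ⟨
  (toℕ i + (toℕ j + toℕ k) % suc n) % suc n    ≡⟨ cong (λ x → (toℕ i + x) % suc n) (toℕ-mod (toℕ j + toℕ k)) ⟨
  (toℕ i + toℕ (j ⊕ k)) % suc n                ∎)
  where open ≡-Reasoning

⊕-identityˡ : (i : Fin (suc n)) → 0F ⊕ i ≡ i
⊕-identityˡ i = toℕ-injective (trans (toℕ-mod (toℕ i)) (m<n⇒m%n≡m (toℕ<n i)))

⊕-inverseˡ : (i : Fin (suc n)) → negF i ⊕ i ≡ 0F
⊕-inverseˡ {n} i = %≡%⇒mod≡mod (toℕ (negF i) + toℕ i) 0 (begin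
  (toℕ (negF i) + toℕ i) % suc n              ≡⟨ cong (λ x → (x + toℕ i) % suc n) (toℕ-mod (suc n ∸ toℕ i)) ⟩
  ((suc n ∸ toℕ i) % suc n + toℕ i) % suc n   ≡⟨ [m%d+n]%d≡[m+n]%d (suc n ∸ toℕ i) (toℕ i) (suc n) ⟩
  (suc n ∸ toℕ i + toℕ i) % suc n             ≡⟨ cong (_% suc n) (m∸n+n≡m (<⇒≤ (toℕ<n i))) ⟩
  suc n % suc n                               ≡⟨ n%n≡0 (suc n) ⟩
  0                                           ∎)
  where open ≡-Reasoning

⊕-⊖ : (i c : Fin (suc n)) → i ⊕ (c ⊖ i) ≡ c
⊕-⊖ i c = begin
  i ⊕ (c ⊕ negF i)   ≡⟨ cong (i ⊕_) (⊕-comm c (negF i)) ⟩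
  i ⊕ (negF i ⊕ c)   ≡⟨ ⊕-assoc i (negF i) c ⟨
  i ⊕ negF i ⊕ c     ≡⟨ cong (_⊕ c) (trans (⊕-comm i (negF i)) (⊕-inverseˡ i)) ⟩
  0F ⊕ c             ≡⟨ ⊕-identityˡ c ⟩
  c                  ∎
  where open ≡-Reasoning

⊕≡⇒≡⊖ : (i j c : Fin (suc n)) → i ⊕ j ≡ c → j ≡ c ⊖ i
⊕≡⇒≡⊖ i j c i⊕j≡c = begin
  j                  ≡⟨ ⊕-identityˡ j ⟨
  0F ⊕ j             ≡⟨ cong (_⊕ j) (⊕-inverseˡ i) ⟨
  negF i ⊕ i ⊕ j     ≡⟨ ⊕-assoc (negF i) i j ⟩
  negF i ⊕ (i ⊕ j)   ≡⟨ cong (negF i ⊕_) i⊕j≡c ⟩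
  negF i ⊕ c         ≡⟨ ⊕-comm (negF i) c ⟩
  c ⊖ i              ∎
  where open ≡-Reasoning

negF-involutive : (i : Fin (suc n)) → negF (negF i) ≡ i
negF-involutive i = sym (trans (⊕≡⇒≡⊖ (negF i) i 0F (⊕-inverseˡ i)) (⊕-identityˡ (negF (negF i))))

⊖-involutive : (c i : Fin (suc n)) → c ⊖ (c ⊖ i) ≡ i
⊖-involutive c i = sym (⊕≡⇒≡⊖ (c ⊖ i) i c (trans (⊕-comm (c ⊖ i) i) (⊕-⊖ i c)))

⊖-⊖ : (b a x : Fin (suc n)) → b ⊖ (a ⊖ x) ≡ b ⊖ a ⊕ x
⊖-⊖ b a x = sym (⊕≡⇒≡⊖ (a ⊖ x) (b ⊖ a ⊕ x) b (begin
  a ⊖ x ⊕ (b ⊖ a ⊕ x)   ≡⟨ cong (a ⊖ x ⊕_) (⊕-comm (b ⊖ a) x) ⟩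
  a ⊖ x ⊕ (x ⊕ (b ⊖ a)) ≡⟨ ⊕-assoc (a ⊖ x) x (b ⊖ a) ⟨
  a ⊖ x ⊕ x ⊕ (b ⊖ a)   ≡⟨ cong (_⊕ (b ⊖ a)) (trans (⊕-comm (a ⊖ x) x) (⊕-⊖ x a)) ⟩
  a ⊕ (b ⊖ a)           ≡⟨ ⊕-⊖ a b ⟩
  b                     ∎))
  where open ≡-Reasoning

⊙-suc : (t : ℕ) (d : Fin (suc n)) → suc t ⊙ d ≡ d ⊕ t ⊙ d
⊙-suc {n} t d = %≡%⇒mod≡mod (toℕ d + t * toℕ d) (toℕ d + toℕ (t ⊙ d)) (begin
  (toℕ d + t * toℕ d) % suc n              ≡⟨ [m+n%d]%d≡[m+n]%d (toℕ d) (t * toℕ d) (suc n) ⟨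
  (toℕ d + (t * toℕ d) % suc n) % suc n    ≡⟨ cong (λ y → (toℕ d + y) % suc n) (toℕ-mod (t * toℕ d)) ⟨
  (toℕ d + toℕ (t ⊙ d)) % suc n            ∎)
  where open ≡-Reasoning

⊙-period : (d : Fin (suc n)) → suc n ⊙ d ≡ 0F
⊙-period {n} d = %≡%⇒mod≡mod (suc n * toℕ d) 0
  (trans (cong (_% suc n) (*-comm (suc n) (toℕ d))) (m*n%n≡0 (toℕ d) (suc n)))

module _ (p-prime : Prime (suc n)) (d : Fin (suc n)) (d≢0 : d ≢ 0F) where

  private
    instance
      d-nonZero : NonZero (toℕ d)
      d-nonZero = ≢-nonZero (λ d≡0 → d≢0 (toℕ-injective d≡0))

    inverse : ∃ λ z → (z * toℕ d) % suc n ≡ 1 % suc n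
    inverse = *-inverse-mod p-prime (toℕ d) (toℕ<n d)

  ⊙-injective : ∀ {t t′} → t < suc n → t′ < suc n → t ⊙ d ≡ t′ ⊙ d → t ≡ t′
  ⊙-injective {t} {t′} t<p t′<p eq = begin
    t                                  ≡⟨ m<n⇒m%n≡m t<p ⟨
    t % suc n                          ≡⟨ cancel t ⟨
    (t * toℕ d * z) % suc n            ≡⟨ [m%d*n]%d≡[m*n]%d (t * toℕ d) z (suc n) ⟨
    ((t * toℕ d) % suc n * z) % suc n  ≡⟨ cong (λ y → (y * z) % suc n) same-residue ⟩
    ((t′ * toℕ d) % suc n * z) % suc n ≡⟨ [m%d*n]%d≡[m*n]%d (t′ * toℕ d) z (suc n) ⟩
    (t′ * toℕ d * z) % suc n           ≡⟨ cancel t′ ⟩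
    t′ % suc n                         ≡⟨ m<n⇒m%n≡m t′<p ⟩
    t′                                 ∎
    where
    open ≡-Reasoning
    z = proj₁ inverse
    cancel = *-inverse-cancel (suc n) (proj₂ inverse)
    same-residue : (t * toℕ d) % suc n ≡ (t′ * toℕ d) % suc n
    same-residue = trans (sym (toℕ-mod (t * toℕ d))) (trans (cong toℕ eq) (toℕ-mod (t′ * toℕ d)))

  ⊙-surjective : ∀ i → ∃ λ t → t < suc n × t ⊙ d ≡ i
  ⊙-surjective i = t , m%n<n (z * toℕ i) (suc n) , toℕ-injective (begin
    toℕ (t ⊙ d)                     ≡⟨ toℕ-mod (t * toℕ d) ⟩
    (t * toℕ d) % suc n             ≡⟨ [m%d*n]%d≡[m*n]%d (z * toℕ i) (toℕ d) (suc n) ⟩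
    (z * toℕ i * toℕ d) % suc n     ≡⟨ cong (_% suc n) (rearrange z (toℕ i) (toℕ d)) ⟩
    (toℕ i * toℕ d * z) % suc n     ≡⟨ *-inverse-cancel (suc n) (proj₂ inverse) (toℕ i) ⟩
    toℕ i % suc n                   ≡⟨ m<n⇒m%n≡m (toℕ<n i) ⟩
    toℕ i                           ∎)
    where
    open ≡-Reasoning
    z = proj₁ inverse
    t = (z * toℕ i) % suc n
    rearrange : ∀ z i x → z * i * x ≡ i * x * z
    rearrange = solve-∀

step : ℕ × Bool → ℕ × Bool
step (t , false) = t , true
step (t , true)  = suc t , false

halve : ℕ → ℕ × Bool
halve zero    = 0 , false
halve (suc m) = step (halve m)

unhalve : ℕ × Bool → ℕ
unhalve (t , false) = 2 * t
unhalve (t , true)  = suc (2 * t)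

unhalve-step : ∀ x → unhalve (step x) ≡ suc (unhalve x)
unhalve-step (t , false) = refl
unhalve-step (t , true)  = *-suc 2 t

unhalve-halve : ∀ m → unhalve (halve m) ≡ m
unhalve-halve zero    = refl
unhalve-halve (suc m) = trans (unhalve-step (halve m)) (cong suc (unhalve-halve m))

halve-unhalve : ∀ x → halve (unhalve x) ≡ x
halve-unhalve (t , false) = halve-double t
  where
  halve-double : ∀ t → halve (2 * t) ≡ (t , false)
  halve-double zero = refl
  halve-double (suc t) = trans (cong halve (*-suc 2 t)) (cong (step ∘ step) (halve-double t))
halve-unhalve (t , true) = cong step (halve-unhalve (t , false))

halve-< : ∀ {m p} → m < 2 * p → proj₁ (halve m) < p
halve-< {m} {p} m<2p =
  *-cancelˡ-< 2 _ _ (≤-<-trans (double≤ (halve m)) (subst (_< 2 * p) (sym (unhalve-halve m)) m<2p))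
  where
  double≤ : ∀ x → 2 * proj₁ x ≤ unhalve x
  double≤ (t , false) = ≤-refl
  double≤ (t , true)  = n≤1+n _

unhalve-< : ∀ {x p} → proj₁ x < p → unhalve x < 2 * p
unhalve-< {t , false} t<p = *-monoʳ-< 2 t<p
unhalve-< {t , true} {p} t<p = subst (_≤ 2 * p) (*-suc 2 t) (*-monoʳ-≤ 2 t<p)

periodic-% : ∀ {A : Set} (f : ℕ → A) {N} .{{_ : NonZero N}} → f N ≡ f 0 → ∀ {m} → m ≤ N → f (m % N) ≡ f m
periodic-% f {N} fN≡f0 m≤N with m≤n⇒m<n∨m≡n m≤N
... | inj₁ m<N = cong f (m<n⇒m%n≡m m<N)
... | inj₂ refl = trans (cong f (n%n≡0 N)) (sym fN≡f0)

toℕ-next : ∀ {m} (i : Fin (suc m)) → toℕ (next i) ≡ suc (toℕ i) % suc m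
toℕ-next i = toℕ-fromℕ< _

rot ref : Fin n → D n
rot i = i , false
ref j = j , true

label : D n → D n → D n
label g h = h · inv g

label-rot-ref : (i j : Fin (suc n)) → label (rot i) (ref j) ≡ ref (i ⊕ j)
label-rot-ref i j = cong ref (trans (cong (j ⊕_) (negF-involutive i)) (⊕-comm j i))

·-ref-involutive : (c : Fin (suc n)) (g : D (suc n)) → ref c · (ref c · g) ≡ g
·-ref-involutive c (i , false) = cong rot (⊖-involutive c i)
·-ref-involutive c (j , true)  = cong ref (⊖-involutive c j)

label-ref· : (c : Fin (suc n)) (g : D (suc n)) → label g (ref c · g) ≡ ref c
label-ref· c (i , false) = trans (label-rot-ref i (c ⊖ i)) (cong ref (⊕-⊖ i c))
label-ref· c (j , true)  = cong ref (trans (⊕-comm (c ⊖ j) j) (⊕-⊖ j c))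

label≡ref⇒≡ref· : (c : Fin (suc n)) (g h : D (suc n)) → label g h ≡ ref c → h ≡ ref c · g
label≡ref⇒≡ref· c (i , false) (j , false) ()
label≡ref⇒≡ref· c (i , true)  (j , true)  ()
label≡ref⇒≡ref· c (i , false) (j , true)  eq = cong ref (⊕≡⇒≡⊖ i j c (cong proj₁ (trans (sym (label-rot-ref i j)) eq)))
label≡ref⇒≡ref· c (j , true)  (i , false) eq = cong rot (⊕≡⇒≡⊖ j i c (trans (⊕-comm j i) (cong proj₁ eq)))

≡ref·⇒label : (c : Fin (suc n)) {g h : D (suc n)} → h ≡ ref c · g → label g h ≡ ref c
≡ref·⇒label c {g} refl = label-ref· c g

≡ref·-sym : (c : Fin (suc n)) {g h : D (suc n)} → h ≡ ref c · g → g ≡ ref c · h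
≡ref·-sym c {g} refl = sym (·-ref-involutive c g)

reflectionMatching : (c : Fin (suc n)) {S : List (D (suc n))} → ref c ∈ S → PerfectMatching (suc n) S
reflectionMatching c c∈S = record
  { mate    = ref c ·_
  ; invol   = ·-ref-involutive c
  ; mateAdj = λ g → subst (_∈ _) (sym (label-ref· c g)) c∈S
  }

module ZigZag (p-prime : Prime (suc n)) {a b : Fin (suc n)} (a≢b : a ≢ b) where

  σ : D (suc n) → D (suc n)
  σ (i , false) = ref a · rot i
  σ (j , true)  = ref b · ref j

  σ-by-reflection : ∀ g → σ g ≡ ref a · g ⊎ σ g ≡ ref b · g
  σ-by-reflection (i , false) = inj₁ refl
  σ-by-reflection (j , true)  = inj₂ refl

  ≡ref·⇒σ : ∀ {g h} → h ≡ ref a · g ⊎ h ≡ ref b · g → h ≡ σ g ⊎ g ≡ σ h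
  ≡ref·⇒σ {i , false} (inj₁ h≡ag) = inj₁ h≡ag
  ≡ref·⇒σ {j , true}  (inj₂ h≡bg) = inj₁ h≡bg
  ≡ref·⇒σ {i , false} (inj₂ refl) = inj₂ (sym (·-ref-involutive b (rot i)))
  ≡ref·⇒σ {j , true}  (inj₁ refl) = inj₂ (sym (·-ref-involutive a (ref j)))

  σ⇒≡ref· : ∀ {g h} → h ≡ σ g ⊎ g ≡ σ h → h ≡ ref a · g ⊎ h ≡ ref b · g
  σ⇒≡ref· {g} (inj₁ refl) = σ-by-reflection g
  σ⇒≡ref· {h = h} (inj₂ refl) with σ-by-reflection h
  ... | inj₁ σh≡ah = inj₁ (≡ref·-sym a σh≡ah)
  ... | inj₂ σh≡bh = inj₂ (≡ref·-sym b σh≡bh)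

  d : Fin (suc n)
  d = b ⊖ a

  d≢0 : d ≢ 0F
  d≢0 d≡0 = a≢b (begin
    a              ≡⟨ ⊕-identityˡ a ⟨
    0F ⊕ a         ≡⟨ cong (_⊕ a) d≡0 ⟨
    b ⊖ a ⊕ a      ≡⟨ ⊕-comm (b ⊖ a) a ⟩
    a ⊕ (b ⊖ a)    ≡⟨ ⊕-⊖ a b ⟩
    b              ∎)
    where open ≡-Reasoning

  -- the vertex at position 2 t + b of the cycle
  vertex : ℕ × Bool → D (suc n)
  vertex (t , false) = rot (t ⊙ d)
  vertex (t , true)  = σ (rot (t ⊙ d))

  vertex-step : ∀ x → vertex (step x) ≡ σ (vertex x)
  vertex-step (t , false) = refl
  vertex-step (t , true)  = cong rot (trans (⊙-suc t d) (sym (⊖-⊖ b a (t ⊙ d))))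

  vertex-injective : ∀ {x y} → proj₁ x < suc n → proj₁ y < suc n → vertex x ≡ vertex y → x ≡ y
  vertex-injective {t , false} {u , false} t<p u<p eq =
    cong (_, false) (⊙-injective p-prime d d≢0 t<p u<p (cong proj₁ eq))
  vertex-injective {t , true}  {u , true}  t<p u<p eq =
    cong (_, true) (⊙-injective p-prime d d≢0 t<p u<p (begin
      t ⊙ d             ≡⟨ ⊖-involutive a (t ⊙ d) ⟨
      a ⊖ (a ⊖ t ⊙ d)   ≡⟨ cong ((a ⊖_) ∘ proj₁) eq ⟩
      a ⊖ (a ⊖ u ⊙ d)   ≡⟨ ⊖-involutive a (u ⊙ d) ⟩
      u ⊙ d             ∎))
    where open ≡-Reasoning
  vertex-injective {t , false} {u , true}  _ _ ()
  vertex-injective {t , true}  {u , false} _ _ ()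

  vertex-surjective : ∀ g → ∃ λ x → proj₁ x < suc n × vertex x ≡ g
  vertex-surjective (i , false) =
    let t , t<p , t⊙d≡i = ⊙-surjective p-prime d d≢0 i
    in (t , false) , t<p , cong rot t⊙d≡i
  vertex-surjective (j , true) =
    let t , t<p , t⊙d≡a⊖j = ⊙-surjective p-prime d d≢0 (a ⊖ j)
    in (t , true) , t<p , cong ref (trans (cong (a ⊖_) t⊙d≡a⊖j) (⊖-involutive a j))

  walk : ℕ → D (suc n)
  walk = vertex ∘ halve

  walk-period : walk (2 * suc n) ≡ walk 0
  walk-period = trans (cong vertex (halve-unhalve (suc n , false))) (cong rot (⊙-period d))

  zigzag : Fin (2 * suc n) → D (suc n)
  zigzag i = walk (toℕ i)

  zigzag-next : ∀ i → zigzag (next i) ≡ σ (zigzag i)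
  zigzag-next i = begin
    walk (toℕ (next i))                ≡⟨ cong walk (toℕ-next i) ⟩
    walk (suc (toℕ i) % (2 * suc n))   ≡⟨ periodic-% walk walk-period (toℕ<n i) ⟩
    walk (suc (toℕ i))                 ≡⟨ vertex-step (halve (toℕ i)) ⟩
    σ (zigzag i)                       ∎
    where open ≡-Reasoning

  zigzag-injective : ∀ {i j} → zigzag i ≡ zigzag j → i ≡ j
  zigzag-injective {i} {j} eq = toℕ-injective (begin
    toℕ i                    ≡⟨ unhalve-halve (toℕ i) ⟨
    unhalve (halve (toℕ i))  ≡⟨ cong unhalve halves≡ ⟩
    unhalve (halve (toℕ j))  ≡⟨ unhalve-halve (toℕ j) ⟩
    toℕ j                    ∎)
    where
    open ≡-Reasoning
    halves≡ : halve (toℕ i) ≡ halve (toℕ j)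
    halves≡ = vertex-injective {halve (toℕ i)} {halve (toℕ j)} (halve-< (toℕ<n i)) (halve-< (toℕ<n j)) eq

  σ-edge-label : ∀ {g h} → h ≡ σ g ⊎ g ≡ σ h → label g h ≡ ref a ⊎ label g h ≡ ref b
  σ-edge-label = Sum.map (≡ref·⇒label a) (≡ref·⇒label b) ∘ σ⇒≡ref·

  module _ {S : List (D (suc n))} (a∈S : ref a ∈ S) (b∈S : ref b ∈ S) where

    hamiltonCycle : HamCycle (suc n) S
    hamiltonCycle = record
      { cyc = zigzag
      ; inj = zigzag-injective
      ; adj = λ i → labelled∈S (σ-edge-label (inj₁ (zigzag-next i)))
      }
      where
      labelled∈S : ∀ {g h} → label g h ≡ ref a ⊎ label g h ≡ ref b → label g h ∈ S
      labelled∈S (inj₁ ≡a) = subst (_∈ S) (sym ≡a) a∈S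
      labelled∈S (inj₂ ≡b) = subst (_∈ S) (sym ≡b) b∈S

    onCycle-σ : ∀ g → OnCycle hamiltonCycle g (σ g)
    onCycle-σ g with vertex-surjective g
    ... | x , x<p , vx≡g = i , inj₁ (zigzag-i≡g , trans (zigzag-next i) (cong σ zigzag-i≡g))
      where
      x<2p : unhalve x < 2 * suc n
      x<2p = unhalve-< {x} x<p
      i = fromℕ< x<2p
      zigzag-i≡g : zigzag i ≡ g
      zigzag-i≡g = trans (cong walk (toℕ-fromℕ< x<2p)) (trans (cong vertex (halve-unhalve x)) vx≡g)

    onCycle⇒labels : ∀ {g h} → OnCycle hamiltonCycle g h → label g h ≡ ref a ⊎ label g h ≡ ref b
    onCycle⇒labels (i , inj₁ (refl , refl)) = σ-edge-label (inj₁ (zigzag-next i))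
    onCycle⇒labels (i , inj₂ (refl , refl)) = σ-edge-label (inj₂ (zigzag-next i))

    labels⇒onCycle : ∀ {g h} → label g h ≡ ref a ⊎ label g h ≡ ref b → OnCycle hamiltonCycle g h
    labels⇒onCycle {g} {h} labelled
      with ≡ref·⇒σ {g} {h} (Sum.map (label≡ref⇒≡ref· a g h) (label≡ref⇒≡ref· b g h) labelled)
    ... | inj₁ refl = onCycle-σ g
    ... | inj₂ refl = map₂ Sum.swap (onCycle-σ h)

data Even {A : Set} : List A → Set where
  []    : Even []
  cons₂ : ∀ x y {xs} → Even xs → Even (x ∷ y ∷ xs)

even-or-odd : ∀ {A : Set} (xs : List A) → Even xs ⊎ ∃₂ λ x ys → xs ≡ x ∷ ys × Even ys
even-or-odd [] = inj₁ []
even-or-odd (x ∷ xs) with even-or-odd xs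
... | inj₁ even                  = inj₂ (x , xs , refl , even)
... | inj₂ (y , ys , refl , even) = inj₁ (cons₂ x y even)

IsReflection : D n → Set
IsReflection g = proj₂ g ≡ true

allReflections : (S : List (D n)) → length (S₁ S) ≡ 0 → All IsReflection S
allReflections []                _  = []
allReflections ((i , true) ∷ S)  no = refl ∷ allReflections S no
allReflections ((i , false) ∷ S) ()

module _ (S : List (D (suc n))) where

  record CycleCover (T : List (D (suc n))) : Set where
    field
      count   : ℕ
      length≡ : length T ≡ 2 * count
      cycles  : Fin count → HamCycle (suc n) S
      labels  : ∀ i g h → OnCycle (cycles i) g h → label g h ∈ T
      covers  : ∀ g h → label g h ∈ T → ExactlyOne (λ i → OnCycle (cycles i) g h)

  emptyCover : CycleCover []
  emptyCover = record
    { count = 0 ; length≡ = refl ; cycles = λ () ; labels = λ () ; covers = λ _ _ () }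

  extendCover : ∀ {x y T} (C : HamCycle (suc n) S) →
                (∀ {g h} → OnCycle C g h → label g h ≡ x ⊎ label g h ≡ y) →
                (∀ {g h} → label g h ≡ x ⊎ label g h ≡ y → OnCycle C g h) →
                x ∉ T → y ∉ T → CycleCover T → CycleCover (x ∷ y ∷ T)
  extendCover {x} {y} {T} C onC⇒ ⇒onC x∉T y∉T cover = record
    { count   = suc count
    ; length≡ = trans (cong (λ m → 2 + m) length≡) (sym (*-suc 2 count))
    ; cycles  = cycles′
    ; labels  = labels′
    ; covers  = covers′
    }
    where
    open CycleCover cover

    fresh : ∀ {g h} → label g h ≡ x ⊎ label g h ≡ y → label g h ∉ T
    fresh (inj₁ ≡x) = x∉T ∘ subst (_∈ T) ≡x
    fresh (inj₂ ≡y) = y∉T ∘ subst (_∈ T) ≡y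

    cycles′ : Fin (suc count) → HamCycle (suc n) S
    cycles′ zero    = C
    cycles′ (suc i) = cycles i

    labels′ : ∀ i g h → OnCycle (cycles′ i) g h → label g h ∈ x ∷ y ∷ T
    labels′ zero    g h on = Sum.[ here , there ∘ here ]′ (onC⇒ on)
    labels′ (suc i) g h on = there (there (labels i g h on))

    onlyNew : ∀ {g h} → label g h ≡ x ⊎ label g h ≡ y → ExactlyOne (λ i → OnCycle (cycles′ i) g h)
    onlyNew {g} {h} new = zero , ⇒onC new , unique
      where
      unique : ∀ i → OnCycle (cycles′ i) g h → i ≡ zero
      unique zero    _  = refl
      unique (suc i) on = ⊥-elim (fresh new (labels i g h on))

    covers′ : ∀ g h → label g h ∈ x ∷ y ∷ T → ExactlyOne (λ i → OnCycle (cycles′ i) g h)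
    covers′ g h (here ≡x)           = onlyNew (inj₁ ≡x)
    covers′ g h (there (here ≡y))   = onlyNew (inj₂ ≡y)
    covers′ g h (there (there l∈T)) =
      let i , on , unique = covers g h l∈T in suc i , on , unique′ unique
      where
      unique′ : ∀ {i} → (∀ j → OnCycle (cycles j) g h → j ≡ i) → ∀ j → OnCycle (cycles′ j) g h → j ≡ suc i
      unique′ _      zero    on = ⊥-elim (fresh (onC⇒ on) l∈T)
      unique′ unique (suc j) on = cong suc (unique j on)

  cover : Prime (suc n) → ∀ {T} → Even T → (∀ {s} → s ∈ T → s ∈ S) → All IsReflection T → Unique T → CycleCover T
  cover p-prime []                                   _    _                     _ = emptyCover
  cover p-prime (cons₂ (a , _) (b , _) {T} even) T⊆S (refl ∷ refl ∷ refls) ((a≢b ∷ a∉T) ∷ b∉T ∷ unique) =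
    extendCover (hamiltonCycle a∈S b∈S) (onCycle⇒labels a∈S b∈S) (labels⇒onCycle a∈S b∈S)
      (All¬⇒¬Any a∉T) (All¬⇒¬Any b∉T) (cover p-prime even (T⊆S ∘ there ∘ there) refls unique)
    where
    open ZigZag p-prime (a≢b ∘ cong ref)
    a∈S = T⊆S (here refl)
    b∈S = T⊆S (there (here refl))

oddDecomposition : ∀ {c : Fin (suc n)} {T} → ref c ∉ T → CycleCover (ref c ∷ T) T → HamDecomposition (suc n) (ref c ∷ T)
oddDecomposition {n} {c} {T} c∉T cover = inj₂ (suc count , length+1≡ , cycles , M , classify)
  where
  open CycleCover cover
  M : PerfectMatching (suc n) (ref c ∷ T)
  M = reflectionMatching c (here refl)
  length+1≡ : length (ref c ∷ T) + 1 ≡ 2 * suc count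
  length+1≡ = trans (+-comm (suc (length T)) 1) (trans (cong (2 +_) length≡) (sym (*-suc 2 count)))
  classify : ∀ g h → Adj (ref c ∷ T) g h →
             (InMatching M g h × (∀ i → ¬ OnCycle (cycles i) g h))
             ⊎ (¬ InMatching M g h × ExactlyOne (λ i → OnCycle (cycles i) g h))
  classify g h (here ≡c)   = inj₁ (label≡ref⇒≡ref· c g h ≡c , λ i on → c∉T (subst (_∈ T) ≡c (labels i g h on)))
  classify g h (there l∈T) = inj₂ ((λ h≡cg → c∉T (subst (_∈ T) (≡ref·⇒label c h≡cg) l∈T)) , covers g h l∈T)

lemma2 : (p : ℕ) → Prime p → 3 ≤ p →
         (S : List (D p)) → Unique S →
         (∀ s → s ∈ S → ¬ IsOne s) →
         (∀ s → s ∈ S → inv s ∈ S) →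
         (∀ g → Generated S g) →
         length (S₁ S) ≡ 0 →
         HamDecomposition p S
lemma2 (suc n) p-prime _ S unique _ _ _ noRotations with even-or-odd S | allReflections S noRotations
... | inj₁ even | refls = inj₁ (count , length≡ , cycles , covers)
  where open CycleCover (cover S p-prime even id refls unique)
lemma2 (suc n) p-prime _ _ (c∉T ∷ uniqueT) _ _ _ _ | inj₂ ((c , _) , T , refl , even) | refl ∷ refls =
  oddDecomposition (All¬⇒¬Any c∉T) (cover (ref c ∷ T) p-prime even there refls uniqueT)
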